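{- Let $G=(V,E)$ be a graph, $k \le |V|$ a nonnegative integer and $0 \le \alpha \le 1$. Let $S$ be a set of $k$ vertices with the largest degrees (ties broken arbitrarily), and let $\mathrm{OPT}$ be the maximum of $\mathrm{cov}_\alpha(S')$ over all $S' \subseteq V$ with $|S'| = k$. Then $\mathrm{cov}_{\alpha}(S) \ge \mathrm{OPT} - 2k^2$. Similarly, let $S$ be a set of $k$ vertices with the smallest degrees (ties broken arbitrarily), and let $\mathrm{OPT}$ be the minimum of $\mathrm{cov}_\alpha(S')$ over all $S' \subseteq V$ with $|S'|=k$. Then $\mathrm{cov}_{\alpha}(S) \le \mathrm{OPT} + 2k^2$.
   Context: Graphs are finite, simple and undirected. For vertex sets $X, Y$, $m(X)$ is the number of edges with both endpoints in $X$ and $m(X,Y)$ is the number of edges with one endpoint in $X$ and the other in $Y$. For $S \subseteq V$, $\mathrm{cov}_{\alpha}(S) = (1-\alpha)\cdot m(S) + \alpha \cdot m(S, V \setminus S)$.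
   Formalization: The parameter α ranges over the rational numbers in [0, 1] rather than the real numbers. -}

module Defs where

open import Data.Nat using (ℕ; _<ᵇ_)
open import Data.Bool using (Bool; true; false; _∧_; if_then_else_)
open import Data.Fin using (Fin; toℕ)
open import Data.Fin.Subset using (Subset; ∁)
open import Data.Vec using (lookup)
open import Data.List using (map; allFin)
open import Data.Nat.ListAction using (sum)
open import Data.Integer using (+_)
open import Data.Rational using (ℚ; _/_; _+_; _*_; _-_; 1ℚ)
open import Relation.Binary.PropositionalEquality using (_≡_)

Σv : ∀ {n} → (Fin n → ℕ) → ℕ
Σv {n} f = sum (map f (allFin n))

𝟙 : Bool → ℕ
𝟙 true  = 1
𝟙 false = 0

record Graph (n : ℕ) : Set where
  field
    adj   : Fin n → Fin n → Bool
    sym   : ∀ u v → adj u v ≡ adj v u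
    irrefl : ∀ v → adj v v ≡ false
open Graph public

_∈ᵇ_ : ∀ {n} → Fin n → Subset n → Bool
u ∈ᵇ X = lookup X u

deg : ∀ {n} → Graph n → Fin n → ℕ
deg G v = Σv λ u → 𝟙 (adj G v u)

-- m(X): edges with both endpoints in X (each edge {u,v} counted once, via u < v)
mIn : ∀ {n} → Graph n → Subset n → ℕ
mIn G X = Σv λ u → Σv λ v →
  𝟙 ((toℕ u <ᵇ toℕ v) ∧ adj G u v ∧ (u ∈ᵇ X) ∧ (v ∈ᵇ X))

-- m(X,Y): edges with one endpoint in X and the other in Y
-- (used for disjoint X, Y, so ordered pairs u ∈ X, v ∈ Y count each edge once)
mBetween : ∀ {n} → Graph n → Subset n → Subset n → ℕ
mBetween G X Y = Σv λ u → Σv λ v →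
  𝟙 (adj G u v ∧ (u ∈ᵇ X) ∧ (v ∈ᵇ Y))

ℕ→ℚ : ℕ → ℚ
ℕ→ℚ m = + m / 1

cov : ∀ {n} → Graph n → ℚ → Subset n → ℚ
cov G α S = (1ℚ - α) * ℕ→ℚ (mIn G S) + α * ℕ→ℚ (mBetween G S (∁ S))

-- Write D(S) for the degree sum of S. Every edge leaving S is counted in D(S), and the remaining
-- pairs counted in D(S) lie inside S, so m(S, V∖S) ≤ D(S) ≤ m(S, V∖S) + |S|², while m(S) ≤ |S|².
-- A set of k vertices of largest degree maximises D among k-sets: there is a threshold t with
-- degrees ≥ t inside S and ≤ t outside, and swapping vertices across t cannot increase D.
-- Hence both terms of cov_α(S') exceed those of cov_α(S) by at most k², and so does their
-- convex combination.
module Submission where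

module DegreeSums where
  open import Defs hiding (sym)
  import Algebra.Properties.Semiring.Sum
  open import Data.Bool using (Bool; true; false; _∧_; not)
  open import Data.Bool.Properties using (not-injective)
  open import Data.Fin using (Fin; zero; suc; toℕ)
  open import Data.Fin.Subset using (Subset; ∁; ∣_∣)
  open import Data.List using (map; tabulate)
  open import Data.List.Properties using (map-tabulate)
  import Data.Nat.ListAction as List
  open import Data.Nat
  open import Data.Nat.Properties
  open import Data.Product using (Σ; _×_; _,_)
  open import Data.Vec using ([]; _∷_)
  open import Data.Vec.Properties using (lookup-map)
  open import Function using (_∘_; id)
  open import Relation.Binary.PropositionalEquality
  open import Relation.Nullary using (contradiction)
  open Algebra.Properties.Semiring.Sum +-*-semiring
    using (sum; sum-cong-≗; ∑-distrib-+; *-distribˡ-sum; *-distribʳ-sum)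

  Σv≡sum : ∀ {n} (f : Fin n → ℕ) → Σv f ≡ sum f
  Σv≡sum {zero} f = refl
  Σv≡sum {suc n} f = cong (f zero +_) (begin
    List.sum (map f (tabulate suc))       ≡⟨ cong List.sum (map-tabulate suc f) ⟩
    List.sum (tabulate (f ∘ suc))         ≡⟨ cong List.sum (map-tabulate id (f ∘ suc)) ⟨
    Σv (f ∘ suc)                          ≡⟨ Σv≡sum (f ∘ suc) ⟩
    sum (f ∘ suc)                         ∎)
    where open ≡-Reasoning

  Σv-Σv≡sum-sum : ∀ {n} (f : Fin n → Fin n → ℕ) → Σv (λ u → Σv (f u)) ≡ sum (λ u → sum (f u))
  Σv-Σv≡sum-sum f =
    trans (Σv≡sum (λ u → Σv (f u))) (sum-cong-≗ {x = λ u → Σv (f u)} (λ u → Σv≡sum (f u)))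

  sum-mono-≤ : ∀ {n} {f g : Fin n → ℕ} → (∀ i → f i ≤ g i) → sum f ≤ sum g
  sum-mono-≤ {zero} f≤g = z≤n
  sum-mono-≤ {suc n} f≤g = +-mono-≤ (f≤g zero) (sum-mono-≤ (f≤g ∘ suc))

  sum-*-sum : ∀ {n} (f g : Fin n → ℕ) → sum (λ u → sum (λ v → f u * g v)) ≡ sum f * sum g
  sum-*-sum f g =
    trans (sum-cong-≗ (λ u → sym (*-distribˡ-sum (f u) g))) (sym (*-distribʳ-sum (sum g) f))

  ∣p∣≡sum𝟙 : ∀ {n} (p : Subset n) → ∣ p ∣ ≡ sum (λ u → 𝟙 (u ∈ᵇ p))
  ∣p∣≡sum𝟙 [] = refl
  ∣p∣≡sum𝟙 (true ∷ p) = cong suc (∣p∣≡sum𝟙 p)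
  ∣p∣≡sum𝟙 (false ∷ p) = ∣p∣≡sum𝟙 p

  ∣p∣*∣p∣≡sum-pairs : ∀ {n} (p : Subset n) →
    ∣ p ∣ * ∣ p ∣ ≡ sum (λ u → sum (λ v → 𝟙 (u ∈ᵇ p) * 𝟙 (v ∈ᵇ p)))
  ∣p∣*∣p∣≡sum-pairs p = trans (cong₂ _*_ (∣p∣≡sum𝟙 p) (∣p∣≡sum𝟙 p))
    (sym (sum-*-sum (λ u → 𝟙 (u ∈ᵇ p)) (λ v → 𝟙 (v ∈ᵇ p))))

  weight : ∀ {n} → (Fin n → ℕ) → Subset n → ℕ
  weight w X = sum (λ u → 𝟙 (u ∈ᵇ X) * w u)

  exchange-above : ∀ s s' d t → (s ≡ true → t ≤ d) → (s ≡ false → d ≤ t) →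
    𝟙 s' * d + 𝟙 s * t ≤ 𝟙 s * d + 𝟙 s' * t
  exchange-above true  true  d t _   _   = ≤-refl
  exchange-above true  false d t t≤d _   =
    subst₂ _≤_ (sym (*-identityˡ t)) (sym (trans (+-identityʳ _) (*-identityˡ d))) (t≤d refl)
  exchange-above false true  d t _   d≤t =
    subst₂ _≤_ (sym (trans (+-identityʳ _) (*-identityˡ d))) (sym (*-identityˡ t)) (d≤t refl)
  exchange-above false false d t _   _   = ≤-refl

  exchange-below : ∀ s s' d t → (s ≡ true → d ≤ t) → (s ≡ false → t ≤ d) →
    𝟙 s * d + 𝟙 s' * t ≤ 𝟙 s' * d + 𝟙 s * t
  exchange-below s s' d t d≤t t≤d = subst₂ _≤_ (+-comm (𝟙 s' * t) (𝟙 s * d)) (+-comm (𝟙 s * t) (𝟙 s' * d))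
    (exchange-above s s' t d d≤t t≤d)

  sum-weight-card : ∀ {n} (w : Fin n → ℕ) t (X Y : Subset n) →
    sum (λ u → 𝟙 (u ∈ᵇ X) * w u + 𝟙 (u ∈ᵇ Y) * t) ≡ weight w X + ∣ Y ∣ * t
  sum-weight-card w t X Y = begin
    sum (λ u → 𝟙 (u ∈ᵇ X) * w u + 𝟙 (u ∈ᵇ Y) * t)
      ≡⟨ ∑-distrib-+ (λ u → 𝟙 (u ∈ᵇ X) * w u) (λ u → 𝟙 (u ∈ᵇ Y) * t) ⟩
    weight w X + sum (λ u → 𝟙 (u ∈ᵇ Y) * t)
      ≡⟨ cong (weight w X +_) (*-distribʳ-sum t (λ u → 𝟙 (u ∈ᵇ Y))) ⟨
    weight w X + sum (λ u → 𝟙 (u ∈ᵇ Y)) * t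
      ≡⟨ cong (λ s → weight w X + s * t) (∣p∣≡sum𝟙 Y) ⟨
    weight w X + ∣ Y ∣ * t ∎
    where open ≡-Reasoning

  weight-≤-above : ∀ {n} (w : Fin n → ℕ) t (S S' : Subset n) → ∣ S ∣ ≡ ∣ S' ∣ →
    (∀ u → u ∈ᵇ S ≡ true → t ≤ w u) → (∀ u → u ∈ᵇ S ≡ false → w u ≤ t) →
    weight w S' ≤ weight w S
  weight-≤-above w t S S' ∣S∣≡∣S'∣ above below = +-cancelʳ-≤ (∣ S ∣ * t) _ _ (begin
    weight w S' + ∣ S ∣ * t                          ≡⟨ sum-weight-card w t S' S ⟨
    sum (λ u → 𝟙 (u ∈ᵇ S') * w u + 𝟙 (u ∈ᵇ S) * t)
      ≤⟨ sum-mono-≤ (λ u → exchange-above (u ∈ᵇ S) (u ∈ᵇ S') (w u) t (above u) (below u)) ⟩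
    sum (λ u → 𝟙 (u ∈ᵇ S) * w u + 𝟙 (u ∈ᵇ S') * t) ≡⟨ sum-weight-card w t S S' ⟩
    weight w S + ∣ S' ∣ * t                          ≡⟨ cong (λ s → weight w S + s * t) ∣S∣≡∣S'∣ ⟨
    weight w S + ∣ S ∣ * t                           ∎)
    where open ≤-Reasoning

  weight-≤-below : ∀ {n} (w : Fin n → ℕ) t (S S' : Subset n) → ∣ S ∣ ≡ ∣ S' ∣ →
    (∀ u → u ∈ᵇ S ≡ true → w u ≤ t) → (∀ u → u ∈ᵇ S ≡ false → t ≤ w u) →
    weight w S ≤ weight w S'
  weight-≤-below w t S S' ∣S∣≡∣S'∣ below above = +-cancelʳ-≤ (∣ S ∣ * t) _ _ (begin
    weight w S + ∣ S ∣ * t                           ≡⟨ cong (λ s → weight w S + s * t) ∣S∣≡∣S'∣ ⟩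
    weight w S + ∣ S' ∣ * t                          ≡⟨ sum-weight-card w t S S' ⟨
    sum (λ u → 𝟙 (u ∈ᵇ S) * w u + 𝟙 (u ∈ᵇ S') * t)
      ≤⟨ sum-mono-≤ (λ u → exchange-below (u ∈ᵇ S) (u ∈ᵇ S') (w u) t (below u) (above u)) ⟩
    sum (λ u → 𝟙 (u ∈ᵇ S') * w u + 𝟙 (u ∈ᵇ S) * t) ≡⟨ sum-weight-card w t S' S ⟩
    weight w S' + ∣ S ∣ * t                          ∎)
    where open ≤-Reasoning

  threshold : ∀ {n} (P : Fin n → Bool) (w : Fin n → ℕ) →
    (∀ u v → P u ≡ true → P v ≡ false → w v ≤ w u) →
    Σ ℕ λ t → (∀ u → P u ≡ true → t ≤ w u) × (∀ v → P v ≡ false → w v ≤ t)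
  threshold {zero} P w separated = 0 , (λ ()) , (λ ())
  threshold {suc n} P w separated
    with threshold (P ∘ suc) (w ∘ suc) (λ u v → separated (suc u) (suc v)) | P zero in P0
  ... | t , above , below | true = w zero ⊓ t , above′ , below′
    where
    above′ : ∀ u → P u ≡ true → w zero ⊓ t ≤ w u
    above′ zero    _  = m⊓n≤m (w zero) t
    above′ (suc u) Pu = ≤-trans (m⊓n≤n (w zero) t) (above u Pu)
    below′ : ∀ v → P v ≡ false → w v ≤ w zero ⊓ t
    below′ zero    Pv = contradiction (trans (sym P0) Pv) λ ()
    below′ (suc v) Pv = ⊓-glb (separated zero (suc v) P0 Pv) (below v Pv)
  ... | t , above , below | false = w zero ⊔ t , above′ , below′
    where
    above′ : ∀ u → P u ≡ true → w zero ⊔ t ≤ w u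
    above′ zero    Pu = contradiction (trans (sym Pu) P0) λ ()
    above′ (suc u) Pu = ⊔-lub (separated (suc u) zero Pu P0) (above u Pu)
    below′ : ∀ v → P v ≡ false → w v ≤ w zero ⊔ t
    below′ zero    _  = m≤m⊔n (w zero) t
    below′ (suc v) Pv = ≤-trans (below v Pv) (m≤n⊔m (w zero) t)

  weight-maximal : ∀ {n} (w : Fin n → ℕ) (S S' : Subset n) → ∣ S ∣ ≡ ∣ S' ∣ →
    (∀ u v → u ∈ᵇ S ≡ true → v ∈ᵇ S ≡ false → w v ≤ w u) → weight w S' ≤ weight w S
  weight-maximal w S S' ∣S∣≡∣S'∣ top with threshold (_∈ᵇ S) w top
  ... | t , above , below = weight-≤-above w t S S' ∣S∣≡∣S'∣ above below

  weight-minimal : ∀ {n} (w : Fin n → ℕ) (S S' : Subset n) → ∣ S ∣ ≡ ∣ S' ∣ →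
    (∀ u v → u ∈ᵇ S ≡ true → v ∈ᵇ S ≡ false → w u ≤ w v) → weight w S ≤ weight w S'
  weight-minimal w S S' ∣S∣≡∣S'∣ bottom
    with threshold (not ∘ (_∈ᵇ S)) w (λ u v ¬u ¬v → bottom v u (not-injective ¬v) (not-injective ¬u))
  ... | t , above , below = weight-≤-below w t S S' ∣S∣≡∣S'∣
    (λ u u∈S → below u (cong not u∈S)) (λ u u∉S → above u (cong not u∉S))

  𝟙-∧ : ∀ a b → 𝟙 (a ∧ b) ≡ 𝟙 a * 𝟙 b
  𝟙-∧ false b = refl
  𝟙-∧ true  b = sym (*-identityˡ (𝟙 b))

  𝟙-∧-≤ʳ : ∀ a b → 𝟙 (a ∧ b) ≤ 𝟙 b
  𝟙-∧-≤ʳ false b = z≤n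
  𝟙-∧-≤ʳ true  b = ≤-refl

  mIn≤∣p∣*∣p∣ : ∀ {n} (G : Graph n) (S : Subset n) → mIn G S ≤ ∣ S ∣ * ∣ S ∣
  mIn≤∣p∣*∣p∣ G S = begin
    mIn G S                                          ≡⟨ Σv-Σv≡sum-sum inside ⟩
    sum (λ u → sum (inside u))                       ≤⟨ sum-mono-≤ (λ u → sum-mono-≤ (inside≤pair u)) ⟩
    sum (λ u → sum (λ v → 𝟙 (u ∈ᵇ S) * 𝟙 (v ∈ᵇ S))) ≡⟨ ∣p∣*∣p∣≡sum-pairs S ⟨
    ∣ S ∣ * ∣ S ∣                                    ∎
    where
    open ≤-Reasoning
    inside : Fin _ → Fin _ → ℕ
    inside u v = 𝟙 ((toℕ u <ᵇ toℕ v) ∧ adj G u v ∧ (u ∈ᵇ S) ∧ (v ∈ᵇ S))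
    inside≤pair : ∀ u v → inside u v ≤ 𝟙 (u ∈ᵇ S) * 𝟙 (v ∈ᵇ S)
    inside≤pair u v = subst (inside u v ≤_) (𝟙-∧ (u ∈ᵇ S) (v ∈ᵇ S))
      (≤-trans (𝟙-∧-≤ʳ (toℕ u <ᵇ toℕ v) _) (𝟙-∧-≤ʳ (adj G u v) _))

  weight-deg : ∀ {n} (G : Graph n) (S : Subset n) →
    weight (deg G) S ≡ sum (λ u → sum (λ v → 𝟙 (u ∈ᵇ S) * 𝟙 (adj G u v)))
  weight-deg G S = sum-cong-≗ {x = λ u → 𝟙 (u ∈ᵇ S) * deg G u} λ u →
    trans (cong (𝟙 (u ∈ᵇ S) *_) (Σv≡sum (λ v → 𝟙 (adj G u v))))
          (*-distribˡ-sum (𝟙 (u ∈ᵇ S)) (λ v → 𝟙 (adj G u v)))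

  mBetween-∁ : ∀ {n} (G : Graph n) (S : Subset n) →
    mBetween G S (∁ S) ≡ sum (λ u → sum (λ v → 𝟙 (adj G u v ∧ u ∈ᵇ S ∧ not (v ∈ᵇ S))))
  mBetween-∁ G S = trans (Σv-Σv≡sum-sum (λ u v → 𝟙 (adj G u v ∧ u ∈ᵇ S ∧ v ∈ᵇ ∁ S)))
    (sum-cong-≗ λ u → sum-cong-≗ λ v → cong (λ b → 𝟙 (adj G u v ∧ u ∈ᵇ S ∧ b)) (lookup-map v not S))

  crossing≤incident : ∀ a s x → 𝟙 (a ∧ s ∧ x) ≤ 𝟙 s * 𝟙 a
  crossing≤incident false s     x     = z≤n
  crossing≤incident true  false x     = z≤n
  crossing≤incident true  true  false = z≤n
  crossing≤incident true  true  true  = ≤-refl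

  incident≤crossing+inside : ∀ a s c → 𝟙 s * 𝟙 a ≤ 𝟙 (a ∧ s ∧ not c) + 𝟙 s * 𝟙 c
  incident≤crossing+inside a     false c     = z≤n
  incident≤crossing+inside false true  c     = z≤n
  incident≤crossing+inside true  true  false = ≤-refl
  incident≤crossing+inside true  true  true  = ≤-refl

  mBetween≤weight-deg : ∀ {n} (G : Graph n) (S : Subset n) → mBetween G S (∁ S) ≤ weight (deg G) S
  mBetween≤weight-deg G S = begin
    mBetween G S (∁ S)
      ≡⟨ mBetween-∁ G S ⟩
    sum (λ u → sum (λ v → 𝟙 (adj G u v ∧ u ∈ᵇ S ∧ not (v ∈ᵇ S))))
      ≤⟨ sum-mono-≤ (λ u → sum-mono-≤ (λ v → crossing≤incident (adj G u v) (u ∈ᵇ S) _)) ⟩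
    sum (λ u → sum (λ v → 𝟙 (u ∈ᵇ S) * 𝟙 (adj G u v)))
      ≡⟨ weight-deg G S ⟨
    weight (deg G) S ∎
    where open ≤-Reasoning

  weight-deg≤mBetween+∣p∣*∣p∣ : ∀ {n} (G : Graph n) (S : Subset n) →
    weight (deg G) S ≤ mBetween G S (∁ S) + ∣ S ∣ * ∣ S ∣
  weight-deg≤mBetween+∣p∣*∣p∣ G S = begin
    weight (deg G) S
      ≡⟨ weight-deg G S ⟩
    sum (λ u → sum (λ v → 𝟙 (u ∈ᵇ S) * 𝟙 (adj G u v)))
      ≤⟨ sum-mono-≤ (λ u → sum-mono-≤ (λ v →
           incident≤crossing+inside (adj G u v) (u ∈ᵇ S) (v ∈ᵇ S))) ⟩
    sum (λ u → sum (λ v → crossing u v + pair u v))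
      ≡⟨ sum-cong-≗ (λ u → ∑-distrib-+ (crossing u) (pair u)) ⟩
    sum (λ u → sum (crossing u) + sum (pair u))
      ≡⟨ ∑-distrib-+ (λ u → sum (crossing u)) (λ u → sum (pair u)) ⟩
    sum (λ u → sum (crossing u)) + sum (λ u → sum (pair u))
      ≡⟨ cong₂ _+_ (mBetween-∁ G S) (∣p∣*∣p∣≡sum-pairs S) ⟨
    mBetween G S (∁ S) + ∣ S ∣ * ∣ S ∣ ∎
    where
    open ≤-Reasoning
    crossing pair : Fin _ → Fin _ → ℕ
    crossing u v = 𝟙 (adj G u v ∧ u ∈ᵇ S ∧ not (v ∈ᵇ S))
    pair u v = 𝟙 (u ∈ᵇ S) * 𝟙 (v ∈ᵇ S)

  mBetween-≤-of-weight-deg-≤ : ∀ {n} (G : Graph n) (X Y : Subset n) →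
    weight (deg G) X ≤ weight (deg G) Y →
    mBetween G X (∁ X) ≤ mBetween G Y (∁ Y) + ∣ Y ∣ * ∣ Y ∣
  mBetween-≤-of-weight-deg-≤ G X Y X≤Y =
    ≤-trans (mBetween≤weight-deg G X) (≤-trans X≤Y (weight-deg≤mBetween+∣p∣*∣p∣ G Y))

module Coverage where
  open import Defs hiding (sym)
  open import Data.Fin.Subset using (Subset; ∁; ∣_∣)
  open import Data.Integer as ℤ using (+_)
  import Data.Integer.Properties as ℤ
  open import Data.Nat as ℕ using (ℕ)
  import Data.Nat.Properties as ℕ
  open import Data.Nat.Coprimality using (1-coprimeTo) renaming (sym to coprime-sym)
  open import Data.Rational hiding (∣_∣)
  open import Data.Rational.Properties
  open import Data.Rational.Solver using (module +-*-Solver)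
  open import Relation.Binary.PropositionalEquality
  open DegreeSums using (weight; mIn≤∣p∣*∣p∣; mBetween-≤-of-weight-deg-≤)
  open +-*-Solver

  integer : ℕ → ℚ
  integer m = mkℚ (+ m) 0 (coprime-sym (1-coprimeTo m))

  ℕ→ℚ≡integer : ∀ m → ℕ→ℚ m ≡ integer m
  ℕ→ℚ≡integer m = normalize-coprime (coprime-sym (1-coprimeTo m))

  ℕ→ℚ-+ : ∀ a b → ℕ→ℚ (a ℕ.+ b) ≡ ℕ→ℚ a + ℕ→ℚ b
  ℕ→ℚ-+ a b = begin
    + (a ℕ.+ b) / 1                                 ≡⟨ cong (_/ 1) numerator ⟩
    (+ a ℤ.* + 1 ℤ.+ + b ℤ.* + 1) / 1               ≡⟨⟩
    integer a + integer b                           ≡⟨ cong₂ _+_ (ℕ→ℚ≡integer a) (ℕ→ℚ≡integer b) ⟨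
    ℕ→ℚ a + ℕ→ℚ b                                   ∎
    where
    open ≡-Reasoning
    numerator : + (a ℕ.+ b) ≡ + a ℤ.* + 1 ℤ.+ + b ℤ.* + 1
    numerator = trans (ℤ.pos-+ a b) (sym (cong₂ ℤ._+_ (ℤ.*-identityʳ (+ a)) (ℤ.*-identityʳ (+ b))))

  ℕ→ℚ-mono-≤ : ∀ {a b} → a ℕ.≤ b → ℕ→ℚ a ≤ ℕ→ℚ b
  ℕ→ℚ-mono-≤ {a} {b} a≤b = subst₂ _≤_ (sym (ℕ→ℚ≡integer a)) (sym (ℕ→ℚ≡integer b))
    (*≤* (ℤ.*-monoʳ-≤-nonNeg (+ 1) (ℤ.+≤+ a≤b)))

  ℕ→ℚ-mono-≤-+ : ∀ {a} b c → a ℕ.≤ b ℕ.+ c → ℕ→ℚ a ≤ ℕ→ℚ b + ℕ→ℚ c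
  ℕ→ℚ-mono-≤-+ {a} b c a≤b+c = subst (ℕ→ℚ a ≤_) (ℕ→ℚ-+ b c) (ℕ→ℚ-mono-≤ a≤b+c)

  p≤q+r⇒p-r≤q : ∀ p q r → p ≤ q + r → p - r ≤ q
  p≤q+r⇒p-r≤q p q r p≤q+r =
    subst (p - r ≤_) (solve 2 (λ q r → (q :+ r) :- r := q) refl q r) (+-monoˡ-≤ (- r) p≤q+r)

  convex-≤ : ∀ {α} → 0ℚ ≤ α → α ≤ 1ℚ → ∀ {x x′ y y′} c → x ≤ x′ + c → y ≤ y′ + c →
    (1ℚ - α) * x + α * y ≤ ((1ℚ - α) * x′ + α * y′) + c
  convex-≤ {α} 0≤α α≤1 {x} {x′} {y} {y′} c x≤x′+c y≤y′+c = begin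
    (1ℚ - α) * x + α * y
      ≤⟨ +-mono-≤ (*-monoˡ-≤-nonNeg (1ℚ - α) {{0≤1-α}} x≤x′+c)
                  (*-monoˡ-≤-nonNeg α {{nonNegative 0≤α}} y≤y′+c) ⟩
    (1ℚ - α) * (x′ + c) + α * (y′ + c)
      ≡⟨ solve 4 (λ α x′ y′ c → (con 1ℚ :- α) :* (x′ :+ c) :+ α :* (y′ :+ c)
                              := ((con 1ℚ :- α) :* x′ :+ α :* y′) :+ c) refl α x′ y′ c ⟩
    ((1ℚ - α) * x′ + α * y′) + c ∎
    where
    open ≤-Reasoning
    0≤1-α : NonNegative (1ℚ - α)
    0≤1-α = nonNegative (subst (_≤ 1ℚ - α) (+-inverseʳ α) (+-monoˡ-≤ (- α) α≤1))

  cov-≤ : ∀ {n} (G : Graph n) {α} → 0ℚ ≤ α → α ≤ 1ℚ → (X Y : Subset n) (c : ℕ) →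
    mIn G X ℕ.≤ mIn G Y ℕ.+ c → mBetween G X (∁ X) ℕ.≤ mBetween G Y (∁ Y) ℕ.+ c →
    cov G α X ≤ cov G α Y + ℕ→ℚ c
  cov-≤ G 0≤α α≤1 X Y c mIn≤ mBetween≤ =
    convex-≤ 0≤α α≤1 (ℕ→ℚ c) (ℕ→ℚ-mono-≤-+ (mIn G Y) c mIn≤)
      (ℕ→ℚ-mono-≤-+ (mBetween G Y (∁ Y)) c mBetween≤)

  cov-≤-of-weight-deg-≤ : ∀ {n} (G : Graph n) {α} → 0ℚ ≤ α → α ≤ 1ℚ → (X Y : Subset n) {k : ℕ} →
    ∣ X ∣ ≡ k → ∣ Y ∣ ≡ k → weight (deg G) X ℕ.≤ weight (deg G) Y →
    cov G α X ≤ cov G α Y + ℕ→ℚ (2 ℕ.* (k ℕ.* k))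
  cov-≤-of-weight-deg-≤ G 0≤α α≤1 X Y {k} ∣X∣≡k ∣Y∣≡k X≤Y =
    cov-≤ G 0≤α α≤1 X Y (2 ℕ.* (k ℕ.* k))
    (ℕ.≤-trans (mIn≤∣p∣*∣p∣ G X) (ℕ.≤-trans (square≤2*square ∣X∣≡k) (ℕ.m≤n+m _ (mIn G Y))))
    (ℕ.≤-trans (mBetween-≤-of-weight-deg-≤ G X Y X≤Y)
               (ℕ.+-monoʳ-≤ (mBetween G Y (∁ Y)) (square≤2*square ∣Y∣≡k)))
    where
    square≤2*square : ∀ {m} → m ≡ k → m ℕ.* m ℕ.≤ 2 ℕ.* (k ℕ.* k)
    square≤2*square refl = ℕ.m≤m+n (k ℕ.* k) (k ℕ.* k ℕ.+ 0)


open import Defs hiding (sym)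
open import Data.Nat using (ℕ; _≤_; _*_)
open import Data.Product using (_×_; _,_)
open import Data.Bool using (true; false)
open import Data.Fin.Subset using (Subset; ∣_∣)
open import Data.Rational using (ℚ; 0ℚ; 1ℚ; _+_; _-_) renaming (_≤_ to _≤ℚ_)
open import Relation.Binary.PropositionalEquality using (_≡_; sym; trans)
open DegreeSums using (weight-maximal; weight-minimal)
open Coverage using (p≤q+r⇒p-r≤q; cov-≤-of-weight-deg-≤)

lemma2 : ∀ {n} (G : Graph n) (k : ℕ) (α : ℚ) → k ≤ n → 0ℚ ≤ℚ α → α ≤ℚ 1ℚ →
    ((S : Subset n) → ∣ S ∣ ≡ k →
      (∀ u v → u ∈ᵇ S ≡ true → v ∈ᵇ S ≡ false → deg G v ≤ deg G u) →
      (S' : Subset n) → ∣ S' ∣ ≡ k →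
      cov G α S' - ℕ→ℚ (2 * (k * k)) ≤ℚ cov G α S)
    × ((S : Subset n) → ∣ S ∣ ≡ k →
      (∀ u v → u ∈ᵇ S ≡ true → v ∈ᵇ S ≡ false → deg G u ≤ deg G v) →
      (S' : Subset n) → ∣ S' ∣ ≡ k →
      cov G α S ≤ℚ cov G α S' + ℕ→ℚ (2 * (k * k)))
lemma2 G k α _ 0≤α α≤1 =
  (λ S ∣S∣≡k top S' ∣S'∣≡k →
    p≤q+r⇒p-r≤q _ _ _ (cov-≤-of-weight-deg-≤ G 0≤α α≤1 S' S ∣S'∣≡k ∣S∣≡k
      (weight-maximal (deg G) S S' (trans ∣S∣≡k (sym ∣S'∣≡k)) top))) ,
  (λ S ∣S∣≡k bottom S' ∣S'∣≡k →
    cov-≤-of-weight-deg-≤ G 0≤α α≤1 S S' ∣S∣≡k ∣S'∣≡k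
      (weight-minimal (deg G) S S' (trans ∣S∣≡k (sym ∣S'∣≡k)) bottom))
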